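{- Let $\theta=9/10$ and $k=6$, and let $d\ge1$. Let $x\in\{0,1\}^{L_d}$ be such that there are at least $4$ choices of $i\in L_1$ for which $\mathbb{P}[X^{(1)}_i=1\mid X^{(d)}(L_{d-1}(i))=x(L_{d-1}(i))]\ge 0.95$. Then $\mathbb{P}[X^{(0)}=1\mid X^{(d)}=x]\ge 19/20$.
   Context: Ising tree model: on the complete $k$-ary tree of depth $d$ ($L_r$ = set of depth-$r$ vertices; $L_r(i)$ = descendants of vertex $i$ that are $r$ levels below it), the root label $X^{(0)}$ is uniform in $\{0,1\}$ and each child independently copies its parent's label with probability $(1+\theta)/2$ and takes the opposite label otherwise; $X^{(r)}$ is the vector of labels at depth $r$, and $X^{(d)}(A)$, $x(A)$ denote restrictions to a set $A$ of leaves. -}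

module Defs where

open import Data.Bool using (Bool; true; false; if_then_else_; _∧_)
open import Data.Nat using (ℕ; zero; suc)
open import Data.Fin using (Fin; zero; suc)
open import Data.Vec using (Vec; []; _∷_)
open import Data.List using (List; []; _∷_; map; concatMap; foldr; filter; allFin)
open import Data.Bool.ListAction using (and)
open import Data.Rational using (ℚ; 0ℚ; 1ℚ; _+_; _*_; _-_; _÷_; ≢-nonZero; _≟_)
open import Relation.Nullary using (yes; no)

half : ℚ
half = Data.Rational._/_ (Data.Integer.+ 1) 2
  where import Data.Integer

-- A full labeling of all vertices of the complete k-ary tree of depth d:
-- the root label together with the labelings of the k subtrees.
data FullLab (k : ℕ) : ℕ → Set where
  leaf : Bool → FullLab k zero
  node : {d : ℕ} → Bool → (Fin k → FullLab k d) → FullLab k (suc d)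

rootLab : ∀ {k d} → FullLab k d → Bool
rootLab (leaf b)   = b
rootLab (node b _) = b

-- Leaf configurations: leaves of depth d indexed by paths (Vec (Fin k) d).
LeafConf : ℕ → ℕ → Set
LeafConf k d = Vec (Fin k) d → Bool

consF : ∀ {A : Set} {k} → A → (Fin k → A) → Fin (suc k) → A
consF a f zero    = a
consF a f (suc i) = f i

allFuns : ∀ {A : Set} (k : ℕ) → List A → List (Fin k → A)
allFuns zero    xs = (λ ()) ∷ []
allFuns (suc k) xs = concatMap (λ a → map (consF a) (allFuns k xs)) xs

allLabs : (k d : ℕ) → List (FullLab k d)
allLabs k zero    = leaf true ∷ leaf false ∷ []
allLabs k (suc d) =
  concatMap (λ b → map (node b) (allFuns k (allLabs k d))) (true ∷ false ∷ [])

prodFin : (k : ℕ) → (Fin k → ℚ) → ℚ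
prodFin zero    f = 1ℚ
prodFin (suc k) f = f zero * prodFin k (λ i → f (suc i))

sumList : List ℚ → ℚ
sumList = foldr _+_ 0ℚ

eqB : Bool → Bool → Bool
eqB true  true  = true
eqB false false = true
eqB _     _     = false

trans : ℚ → Bool → Bool → ℚ
trans θ a b = if eqB a b then half * (1ℚ + θ) else half * (1ℚ - θ)

edgeWeight : ∀ {k d} → ℚ → FullLab k d → ℚ
edgeWeight {k} θ (leaf b)    = 1ℚ
edgeWeight {k} θ (node b ch) =
  prodFin k (λ i → trans θ b (rootLab (ch i)) * edgeWeight θ (ch i))

-- Probability of a full labeling (uniform root).
weight : ∀ {k d} → ℚ → FullLab k d → ℚ
weight θ σ = half * edgeWeight θ σ

Prob : (k d : ℕ) → ℚ → (FullLab k d → Bool) → ℚ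
Prob k d θ E = sumList (map (weight θ) (filter (λ σ → E σ Data.Bool.≟ true) (allLabs k d)))
  where import Data.Bool

-- Conditional probability P[A | B] = P[A ∧ B] / P[B]  (defined as 0 if P[B] = 0).
CondProb : (k d : ℕ) → ℚ → (FullLab k d → Bool) → (FullLab k d → Bool) → ℚ
CondProb k d θ A B with Prob k d θ B ≟ 0ℚ
... | yes _  = 0ℚ
... | no ne  = _÷_ (Prob k d θ (λ σ → A σ ∧ B σ)) (Prob k d θ B) {{≢-nonZero ne}}

leavesMatch : ∀ {k d} → LeafConf k d → FullLab k d → Bool
leavesMatch {k} x (leaf b)    = eqB b (x [])
leavesMatch {k} x (node b ch) = and (map (λ i → leavesMatch (λ p → x (i ∷ p)) (ch i)) (allFin k))

rootIsOne : ∀ {k d} → FullLab k d → Bool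
rootIsOne σ = rootLab σ

childIsOne : ∀ {k d} → Fin k → FullLab k (suc d) → Bool
childIsOne i (node b ch) = rootLab (ch i)

-- Event X^{(d)}(L_{d-1}(i)) = x(L_{d-1}(i)): the leaves below child i agree with x.
subLeavesMatch : ∀ {k d} → LeafConf k (suc d) → Fin k → FullLab k (suc d) → Bool
subLeavesMatch x i (node b ch) = leavesMatch (λ p → x (i ∷ p)) (ch i)

module Submission where

-- For a leaf configuration y of a depth-d tree let lik θ c y be (twice) the probability that
-- the leaves show y and the root has label c, i.e. the likelihood of y given root label c, and
-- let parentLik θ b y = Σ_c P(b → c) · lik θ c y be the likelihood of y given the label b of
-- the root's parent.  Three identities, valid for every k and θ, drive the proof:
--   (1) P[X⁰ = 1 ∧ leaves = y] = ½ L₁(y) and P[leaves = y] = ½ (L₁(y) + L₀(y)), writing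
--       L_c = lik θ c, so the root posterior is L₁ / (L₁ + L₀);
--   (2) L_c(x) = ∏_j parentLik θ c (x_j) over the k subtrees of the root;
--   (3) an event that only looks at the subtree of a child has the same probability as the
--       corresponding event in a tree of depth d - 1 (the child's label is again uniform).
-- By (3) and (1) the hypothesis on a child i says 19 L₀(x_i) ≤ L₁(x_i); for θ = 9/10 this gives
-- parentLik 1 ≥ (181/19) parentLik 0 on x_i, while every child has parentLik 1 ≥ (1/19) parentLik 0.
-- With at least four good children out of six, (2) yields L₁(x) ≥ (181/19)⁴ (1/19)² L₀(x) ≥ 19 L₀(x),
-- i.e. a root posterior of at least 19/20 by (1).

open import Defs
open import Data.Bool using (Bool; true; false; _∧_; if_then_else_)
import Data.Bool
open import Data.Empty using (⊥-elim)
open import Data.Fin using (Fin; zero; suc; _≟_)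
open import Data.Fin.Subset using (Subset; _∈_; ∣_∣; ∁; inside; outside)
open import Data.Fin.Subset.Properties using (∣p∣≤n; ∣∁p∣≡n∸∣p∣)
open import Data.Integer using (+_)
open import Data.List using (List; []; _∷_; map; concatMap; filter; tabulate; _++_)
open import Data.Bool.ListAction using (and)
open import Data.Nat using (ℕ; zero; suc; _≤_; _∸_; s≤s)
open import Data.Product using (Σ; _×_; _,_)
open import Data.Rational using (ℚ; 0ℚ; 1ℚ; _+_; _*_; _-_; -_; _/_; _÷_; 1/_; ≢-nonZero)
import Data.Rational as Q
open import Algebra.Definitions.RawSemiring Q.+-*-rawSemiring using (_^_)
import Data.Rational.Properties as Qₚ
open import Data.Rational.Solver using (module +-*-Solver)
open +-*-Solver using (solve; _:+_; _:*_; _:-_; _:=_; con)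
open import Data.Vec using ([]; _∷_; lookup)
open import Data.Vec.Properties using (lookup⇒[]=)
open import Relation.Binary.PropositionalEquality
  using (_≡_; refl; sym; cong; cong₂; subst; subst₂; module ≡-Reasoning)
  renaming (trans to ≡-trans)
open import Relation.Nullary using (Dec; does; yes; no; ¬_)

≤-byGap : ∀ {a b c} → a ≡ b + c → 0ℚ Q.≤ c → b Q.≤ a
≤-byGap {a} {b} {c} a≡b+c 0≤c = begin
  b       ≡⟨ sym (Qₚ.+-identityʳ b) ⟩
  b + 0ℚ  ≤⟨ Qₚ.+-monoʳ-≤ b 0≤c ⟩
  b + c   ≡⟨ sym a≡b+c ⟩
  a       ∎
  where open Qₚ.≤-Reasoning

0≤-difference : ∀ {a b} → b Q.≤ a → 0ℚ Q.≤ a - b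
0≤-difference {a} {b} b≤a =
  Qₚ.≤-trans (Qₚ.≤-reflexive (sym (Qₚ.+-inverseʳ b))) (Qₚ.+-monoˡ-≤ (- b) b≤a)

0≤-* : ∀ {a b} → 0ℚ Q.≤ a → 0ℚ Q.≤ b → 0ℚ Q.≤ a * b
0≤-* {a} {b} 0≤a 0≤b =
  Qₚ.nonNegative⁻¹ _ {{Qₚ.nonNeg*nonNeg⇒nonNeg a {{Q.nonNegative 0≤a}} b {{Q.nonNegative 0≤b}}}}

0<-* : ∀ {a b} → 0ℚ Q.< a → 0ℚ Q.< b → 0ℚ Q.< a * b
0<-* {a} {b} 0<a 0<b =
  Qₚ.positive⁻¹ _ {{Qₚ.pos*pos⇒pos a {{Q.positive 0<a}} b {{Q.positive 0<b}}}}

0<-+ : ∀ {a b} → 0ℚ Q.< a → 0ℚ Q.≤ b → 0ℚ Q.< a + b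
0<-+ 0<a 0≤b = Qₚ.+-mono-<-≤ 0<a 0≤b

half-cancel : ∀ c u v → c * (half * u) Q.≤ half * v → c * u Q.≤ v
half-cancel c u v h = Qₚ.*-cancelˡ-≤-pos half (Qₚ.≤-trans (Qₚ.≤-reflexive (swap-half c u)) h)
  where
  swap-half : ∀ c u → half * (c * u) ≡ c * (half * u)
  swap-half = solve 2 (λ c u → con half :* (c :* u) := c :* (con half :* u)) refl

half-scale : ∀ c u v → c * u Q.≤ v → c * (half * u) Q.≤ half * v
half-scale c u v h = Qₚ.≤-trans (Qₚ.≤-reflexive (swap-half c u)) (Qₚ.*-monoˡ-≤-nonNeg half h)
  where
  swap-half : ∀ c u → c * (half * u) ≡ half * (c * u)
  swap-half = solve 2 (λ c u → c :* (con half :* u) := con half :* (c :* u)) refl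

sumOver : {A : Set} → List A → (A → ℚ) → ℚ
sumOver xs f = sumList (map f xs)

sumOver-cong : {A : Set} (xs : List A) {f g : A → ℚ} →
  (∀ a → f a ≡ g a) → sumOver xs f ≡ sumOver xs g
sumOver-cong []       f≡g = refl
sumOver-cong (x ∷ xs) f≡g = cong₂ _+_ (f≡g x) (sumOver-cong xs f≡g)

sumOver-++ : {A : Set} (xs ys : List A) (f : A → ℚ) →
  sumOver (xs ++ ys) f ≡ sumOver xs f + sumOver ys f
sumOver-++ []       ys f = sym (Qₚ.+-identityˡ _)
sumOver-++ (x ∷ xs) ys f =
  ≡-trans (cong (_+_ (f x)) (sumOver-++ xs ys f)) (sym (Qₚ.+-assoc (f x) _ _))

sumOver-map : {A B : Set} (xs : List A) (h : A → B) (f : B → ℚ) →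
  sumOver (map h xs) f ≡ sumOver xs (λ a → f (h a))
sumOver-map []       h f = refl
sumOver-map (x ∷ xs) h f = cong (_+_ (f (h x))) (sumOver-map xs h f)

sumOver-concatMap : {A B : Set} (xs : List A) (g : A → List B) (f : B → ℚ) →
  sumOver (concatMap g xs) f ≡ sumOver xs (λ a → sumOver (g a) f)
sumOver-concatMap []       g f = refl
sumOver-concatMap (x ∷ xs) g f =
  ≡-trans (sumOver-++ (g x) (concatMap g xs) f) (cong (_+_ (sumOver (g x) f)) (sumOver-concatMap xs g f))

sumOver-+ : {A : Set} (xs : List A) (f g : A → ℚ) →
  sumOver xs (λ a → f a + g a) ≡ sumOver xs f + sumOver xs g
sumOver-+ []       f g = refl
sumOver-+ (x ∷ xs) f g =
  ≡-trans (cong (_+_ (f x + g x)) (sumOver-+ xs f g))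
          (interchange (f x) (g x) (sumOver xs f) (sumOver xs g))
  where
  interchange : ∀ a b c d → (a + b) + (c + d) ≡ (a + c) + (b + d)
  interchange = solve 4 (λ a b c d → (a :+ b) :+ (c :+ d) := (a :+ c) :+ (b :+ d)) refl

sumOver-*ˡ : {A : Set} (xs : List A) (c : ℚ) (f : A → ℚ) →
  sumOver xs (λ a → c * f a) ≡ c * sumOver xs f
sumOver-*ˡ []       c f = sym (Qₚ.*-zeroʳ c)
sumOver-*ˡ (x ∷ xs) c f =
  ≡-trans (cong (_+_ (c * f x)) (sumOver-*ˡ xs c f)) (sym (Qₚ.*-distribˡ-+ c (f x) (sumOver xs f)))

sumOver-*ʳ : {A : Set} (xs : List A) (c : ℚ) (f : A → ℚ) →
  sumOver xs (λ a → f a * c) ≡ sumOver xs f * c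
sumOver-*ʳ xs c f =
  ≡-trans (sumOver-cong xs (λ a → Qₚ.*-comm (f a) c)) (≡-trans (sumOver-*ˡ xs c f) (Qₚ.*-comm c _))

sumOver-zero : {A : Set} (xs : List A) → sumOver xs (λ _ → 0ℚ) ≡ 0ℚ
sumOver-zero []       = refl
sumOver-zero (x ∷ xs) = cong (_+_ 0ℚ) (sumOver-zero xs)

sumOver-swap : {A B : Set} (xs : List A) (ys : List B) (f : A → B → ℚ) →
  sumOver xs (λ a → sumOver ys (f a)) ≡ sumOver ys (λ b → sumOver xs (λ a → f a b))
sumOver-swap []       ys f = sym (sumOver-zero ys)
sumOver-swap (x ∷ xs) ys f =
  ≡-trans (cong (_+_ (sumOver ys (f x))) (sumOver-swap xs ys f))
          (sym (sumOver-+ ys (f x) (λ b → sumOver xs (λ a → f a b))))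

sumOver-nonneg : {A : Set} (xs : List A) (f : A → ℚ) →
  (∀ a → 0ℚ Q.≤ f a) → 0ℚ Q.≤ sumOver xs f
sumOver-nonneg []       f 0≤f = Qₚ.≤-refl
sumOver-nonneg (x ∷ xs) f 0≤f = Qₚ.+-mono-≤ (0≤f x) (sumOver-nonneg xs f 0≤f)

ind : Bool → ℚ
ind true  = 1ℚ
ind false = 0ℚ

ind-∧ : ∀ a b → ind (a ∧ b) ≡ ind a * ind b
ind-∧ true  b = sym (Qₚ.*-identityˡ (ind b))
ind-∧ false b = sym (Qₚ.*-zeroˡ (ind b))

ind-nonneg : ∀ a → 0ℚ Q.≤ ind a
ind-nonneg true  = Qₚ.≤ᵇ⇒≤ _
ind-nonneg false = Qₚ.≤-refl

sumOver-filter : {A : Set} (xs : List A) (w : A → ℚ) (E : A → Bool) →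
  sumList (map w (filter (λ a → E a Data.Bool.≟ true) xs)) ≡ sumOver xs (λ a → w a * ind (E a))
sumOver-filter []       w E = refl
sumOver-filter (x ∷ xs) w E with E x
... | true  = cong₂ _+_ (sym (Qₚ.*-identityʳ (w x))) (sumOver-filter xs w E)
... | false = begin
  sumList (map w (filter (λ a → E a Data.Bool.≟ true) xs)) ≡⟨ sumOver-filter xs w E ⟩
  rest                                                     ≡⟨ sym (Qₚ.+-identityˡ rest) ⟩
  0ℚ + rest                                                ≡⟨ cong (_+ rest) (sym (Qₚ.*-zeroʳ (w x))) ⟩
  w x * 0ℚ + rest                                          ∎
  where
  open ≡-Reasoning
  rest : ℚ
  rest = sumOver xs (λ a → w a * ind (E a))

prodFin-cong : ∀ k {f g : Fin k → ℚ} → (∀ i → f i ≡ g i) → prodFin k f ≡ prodFin k g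
prodFin-cong zero    f≡g = refl
prodFin-cong (suc k) f≡g = cong₂ _*_ (f≡g zero) (prodFin-cong k (λ i → f≡g (suc i)))

prodFin-* : ∀ k (f g : Fin k → ℚ) → prodFin k f * prodFin k g ≡ prodFin k (λ i → f i * g i)
prodFin-* zero    f g = refl
prodFin-* (suc k) f g =
  ≡-trans (interchange (f zero) (prodFin k (λ i → f (suc i))) (g zero) (prodFin k (λ i → g (suc i))))
          (cong (f zero * g zero *_) (prodFin-* k (λ i → f (suc i)) (λ i → g (suc i))))
  where
  interchange : ∀ a b c d → (a * b) * (c * d) ≡ (a * c) * (b * d)
  interchange = solve 4 (λ a b c d → (a :* b) :* (c :* d) := (a :* c) :* (b :* d)) refl

prodFin-1 : ∀ k → prodFin k (λ _ → 1ℚ) ≡ 1ℚ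
prodFin-1 zero    = refl
prodFin-1 (suc k) = cong (1ℚ *_) (prodFin-1 k)

prodFin-nonneg : ∀ k (f : Fin k → ℚ) → (∀ i → 0ℚ Q.≤ f i) → 0ℚ Q.≤ prodFin k f
prodFin-nonneg zero    f 0≤f = Qₚ.≤ᵇ⇒≤ _
prodFin-nonneg (suc k) f 0≤f = 0≤-* (0≤f zero) (prodFin-nonneg k _ (λ i → 0≤f (suc i)))

prodFin-pos : ∀ k (f : Fin k → ℚ) → (∀ i → 0ℚ Q.< f i) → 0ℚ Q.< prodFin k f
prodFin-pos zero    f 0<f = Qₚ.positive⁻¹ 1ℚ
prodFin-pos (suc k) f 0<f = 0<-* (0<f zero) (prodFin-pos k _ (λ i → 0<f (suc i)))

prodFin-mono : ∀ k (u v : Fin k → ℚ) → (∀ i → 0ℚ Q.≤ u i) → (∀ i → u i Q.≤ v i) →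
  prodFin k u Q.≤ prodFin k v
prodFin-mono zero    u v 0≤u u≤v = Qₚ.≤-refl
prodFin-mono (suc k) u v 0≤u u≤v =
  Qₚ.≤-trans (Qₚ.*-monoˡ-≤-nonNeg (u zero) {{Q.nonNegative (0≤u zero)}} tail≤)
             (Qₚ.*-monoʳ-≤-nonNeg (prodFin k (λ i → v (suc i))) {{Q.nonNegative 0≤tail}} (u≤v zero))
  where
  tail≤ : prodFin k (λ i → u (suc i)) Q.≤ prodFin k (λ i → v (suc i))
  tail≤ = prodFin-mono k _ _ (λ i → 0≤u (suc i)) (λ i → u≤v (suc i))
  0≤tail : 0ℚ Q.≤ prodFin k (λ i → v (suc i))
  0≤tail = Qₚ.≤-trans (prodFin-nonneg k _ (λ i → 0≤u (suc i))) tail≤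

single : ∀ {k} → Fin k → Fin k → ℚ → ℚ
single i j q = if does (i ≟ j) then q else 1ℚ

prodFin-single : ∀ k (i : Fin k) (f : Fin k → ℚ) → prodFin k (λ j → single i j (f j)) ≡ f i
prodFin-single (suc k) zero    f =
  ≡-trans (cong (f zero *_) (prodFin-1 k)) (Qₚ.*-identityʳ (f zero))
prodFin-single (suc k) (suc i) f =
  ≡-trans (Qₚ.*-identityˡ _) (prodFin-single k i (λ j → f (suc j)))

select : ∀ {k} → Subset k → ℚ → ℚ → Fin k → ℚ
select S a b j = if lookup S j then a else b

prodFin-select : ∀ {k} (S : Subset k) (a b : ℚ) → prodFin k (select S a b) ≡ a ^ ∣ S ∣ * b ^ ∣ ∁ S ∣
prodFin-select []           a b = refl
prodFin-select (inside  ∷ S) a b =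
  ≡-trans (cong (a *_) (prodFin-select S a b)) (sym (Qₚ.*-assoc a (a ^ ∣ S ∣) (b ^ ∣ ∁ S ∣)))
prodFin-select (outside ∷ S) a b =
  ≡-trans (cong (b *_) (prodFin-select S a b)) (rotate b (a ^ ∣ S ∣) (b ^ ∣ ∁ S ∣))
  where
  rotate : ∀ b p q → b * (p * q) ≡ p * (b * q)
  rotate = solve 3 (λ b p q → b :* (p :* q) := p :* (b :* q)) refl

select-nonneg : ∀ {k} (S : Subset k) {a b : ℚ} → 0ℚ Q.≤ a → 0ℚ Q.≤ b → ∀ j → 0ℚ Q.≤ select S a b j
select-nonneg S 0≤a 0≤b j with lookup S j
... | true  = 0≤a
... | false = 0≤b

prodFin-ratio : ∀ k (m : ℚ) (c u v : Fin k → ℚ) → (∀ j → 0ℚ Q.≤ c j) → (∀ j → 0ℚ Q.≤ v j) →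
  m Q.≤ prodFin k c → (∀ j → c j * v j Q.≤ u j) → m * prodFin k v Q.≤ prodFin k u
prodFin-ratio k m c u v 0≤c 0≤v m≤∏c cv≤u = begin
  m * prodFin k v             ≤⟨ Qₚ.*-monoʳ-≤-nonNeg (prodFin k v) {{Q.nonNegative (prodFin-nonneg k v 0≤v)}} m≤∏c ⟩
  prodFin k c * prodFin k v   ≡⟨ prodFin-* k c v ⟩
  prodFin k (λ j → c j * v j) ≤⟨ prodFin-mono k _ u (λ j → 0≤-* (0≤c j) (0≤v j)) cv≤u ⟩
  prodFin k u                 ∎
  where open Qₚ.≤-Reasoning

allFuns-prod : {A : Set} (k : ℕ) (xs : List A) (h : Fin k → A → ℚ) →
  sumOver (allFuns k xs) (λ ch → prodFin k (λ i → h i (ch i))) ≡ prodFin k (λ i → sumOver xs (h i))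
allFuns-prod zero    xs h = Qₚ.+-identityʳ 1ℚ
allFuns-prod (suc k) xs h = begin
  sumOver (concatMap (λ a → map (consF a) (allFuns k xs)) xs) F
    ≡⟨ sumOver-concatMap xs _ F ⟩
  sumOver xs (λ a → sumOver (map (consF a) (allFuns k xs)) F)
    ≡⟨ sumOver-cong xs (λ a → sumOver-map (allFuns k xs) (consF a) F) ⟩
  sumOver xs (λ a → sumOver (allFuns k xs) (λ f → h zero a * rest f))
    ≡⟨ sumOver-cong xs (λ a → sumOver-*ˡ (allFuns k xs) (h zero a) rest) ⟩
  sumOver xs (λ a → h zero a * sumOver (allFuns k xs) rest)
    ≡⟨ sumOver-cong xs (λ a → cong (h zero a *_) (allFuns-prod k xs (λ i → h (suc i)))) ⟩
  sumOver xs (λ a → h zero a * prodFin k (λ i → sumOver xs (h (suc i))))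
    ≡⟨ sumOver-*ʳ xs _ (h zero) ⟩
  sumOver xs (h zero) * prodFin k (λ i → sumOver xs (h (suc i))) ∎
  where
  open ≡-Reasoning
  F : (Fin (suc k) → _) → ℚ
  F ch = prodFin (suc k) (λ i → h i (ch i))
  rest : (Fin k → _) → ℚ
  rest f = prodFin k (λ i → h (suc i) (f i))

ind-and : ∀ k {A : Set} (f : A → Bool) (g : Fin k → A) →
  ind (and (map f (tabulate g))) ≡ prodFin k (λ i → ind (f (g i)))
ind-and zero    f g = refl
ind-and (suc k) f g =
  ≡-trans (ind-∧ (f (g zero)) _) (cong (ind (f (g zero)) *_) (ind-and k f (λ i → g (suc i))))

labels : List Bool
labels = true ∷ false ∷ []

sumOver-labels-ind : ∀ c (f : Bool → ℚ) → sumOver labels (λ b → ind (eqB b c) * f b) ≡ f c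
sumOver-labels-ind true  f = solve 2 (λ t u → con 1ℚ :* t :+ (con 0ℚ :* u :+ con 0ℚ) := t) refl (f true) (f false)
sumOver-labels-ind false f = solve 2 (λ t u → con 0ℚ :* t :+ (con 1ℚ :* u :+ con 0ℚ) := u) refl (f true) (f false)

trans-rowSum : ∀ θ b u → sumOver labels (λ c → trans θ b c * u) ≡ u
trans-rowSum θ true  u = solve 2 (λ θ u →
  con half :* (con 1ℚ :+ θ) :* u :+ (con half :* (con 1ℚ :- θ) :* u :+ con 0ℚ) := u) refl θ u
trans-rowSum θ false u = solve 2 (λ θ u →
  con half :* (con 1ℚ :- θ) :* u :+ (con half :* (con 1ℚ :+ θ) :* u :+ con 0ℚ) := u) refl θ u

trans-colSum : ∀ θ c u → sumOver labels (λ b → trans θ b c * u) ≡ u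
trans-colSum θ true  u = trans-rowSum θ true u
trans-colSum θ false u = trans-rowSum θ false u

sumLabs-node : ∀ k d θ (F : FullLab k (suc d) → ℚ) (φ : Bool → ℚ) (g : Fin k → FullLab k d → ℚ) →
  (∀ b ch → F (node b ch) ≡ φ b * prodFin k (λ j → g j (ch j))) →
  sumOver (allLabs k (suc d)) (λ σ → edgeWeight θ σ * F σ) ≡
  sumOver labels (λ b → φ b * prodFin k (λ j →
    sumOver (allLabs k d) (λ τ → trans θ b (rootLab τ) * edgeWeight θ τ * g j τ)))
sumLabs-node k d θ F φ g F-factors = begin
  sumOver (allLabs k (suc d)) (λ σ → edgeWeight θ σ * F σ)
    ≡⟨ sumOver-concatMap labels (λ b → map (node b) subtrees) (λ σ → edgeWeight θ σ * F σ) ⟩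
  sumOver labels (λ b → sumOver (map (node b) subtrees) (λ σ → edgeWeight θ σ * F σ))
    ≡⟨ sumOver-cong labels (λ b → sumOver-map subtrees (node b) (λ σ → edgeWeight θ σ * F σ)) ⟩
  sumOver labels (λ b → sumOver subtrees (λ ch → edgeWeight θ (node b ch) * F (node b ch)))
    ≡⟨ sumOver-cong labels (λ b → sumOver-cong subtrees (summand b)) ⟩
  sumOver labels (λ b → sumOver subtrees (λ ch → φ b * prodFin k (λ j → h b j (ch j))))
    ≡⟨ sumOver-cong labels (λ b → sumOver-*ˡ subtrees (φ b) (λ ch → prodFin k (λ j → h b j (ch j)))) ⟩
  sumOver labels (λ b → φ b * sumOver subtrees (λ ch → prodFin k (λ j → h b j (ch j))))
    ≡⟨ sumOver-cong labels (λ b → cong (φ b *_) (allFuns-prod k (allLabs k d) (h b))) ⟩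
  sumOver labels (λ b → φ b * prodFin k (λ j → sumOver (allLabs k d) (h b j))) ∎
  where
  open ≡-Reasoning
  subtrees : List (Fin k → FullLab k d)
  subtrees = allFuns k (allLabs k d)
  h : Bool → Fin k → FullLab k d → ℚ
  h b j τ = trans θ b (rootLab τ) * edgeWeight θ τ * g j τ
  summand : ∀ b ch → edgeWeight θ (node b ch) * F (node b ch) ≡ φ b * prodFin k (λ j → h b j (ch j))
  summand b ch = begin
    edgeWeight θ (node b ch) * F (node b ch)
      ≡⟨ cong (edgeWeight θ (node b ch) *_) (F-factors b ch) ⟩
    edgeWeight θ (node b ch) * (φ b * prodFin k (λ j → g j (ch j)))
      ≡⟨ rotate (edgeWeight θ (node b ch)) (φ b) _ ⟩
    φ b * (edgeWeight θ (node b ch) * prodFin k (λ j → g j (ch j)))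
      ≡⟨ cong (φ b *_) (prodFin-* k (λ j → trans θ b (rootLab (ch j)) * edgeWeight θ (ch j)) (λ j → g j (ch j))) ⟩
    φ b * prodFin k (λ j → h b j (ch j)) ∎
    where
    rotate : ∀ a p q → a * (p * q) ≡ p * (a * q)
    rotate = solve 3 (λ a p q → a :* (p :* q) := p :* (a :* q)) refl

total-mass : ∀ k d θ b → sumOver (allLabs k d) (λ τ → trans θ b (rootLab τ) * edgeWeight θ τ) ≡ 1ℚ
total-mass k zero    θ b = trans-rowSum θ b 1ℚ
total-mass k (suc d) θ b = begin
  sumOver (allLabs k (suc d)) (λ τ → trans θ b (rootLab τ) * edgeWeight θ τ)
    ≡⟨ sumOver-cong (allLabs k (suc d)) (λ τ → Qₚ.*-comm (trans θ b (rootLab τ)) _) ⟩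
  sumOver (allLabs k (suc d)) (λ τ → edgeWeight θ τ * trans θ b (rootLab τ))
    ≡⟨ sumLabs-node k d θ _ (trans θ b) (λ _ _ → 1ℚ) (λ c ch → sym (times-prodFin-1 (trans θ b c))) ⟩
  sumOver labels (λ c → trans θ b c * prodFin k (λ j →
    sumOver (allLabs k d) (λ τ → trans θ c (rootLab τ) * edgeWeight θ τ * 1ℚ)))
    ≡⟨ sumOver-cong labels (λ c → cong (trans θ b c *_) (≡-trans (prodFin-cong k (λ _ → subtree c)) (prodFin-1 k))) ⟩
  sumOver labels (λ c → trans θ b c * 1ℚ)
    ≡⟨ trans-rowSum θ b 1ℚ ⟩
  1ℚ ∎
  where
  open ≡-Reasoning
  times-prodFin-1 : ∀ q → q * prodFin k (λ _ → 1ℚ) ≡ q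
  times-prodFin-1 q = ≡-trans (cong (q *_) (prodFin-1 k)) (Qₚ.*-identityʳ q)
  subtree : ∀ c → sumOver (allLabs k d) (λ τ → trans θ c (rootLab τ) * edgeWeight θ τ * 1ℚ) ≡ 1ℚ
  subtree c = ≡-trans (sumOver-cong (allLabs k d) (λ τ → Qₚ.*-identityʳ _)) (total-mass k d θ c)

mass : ∀ {k d} → ℚ → (FullLab k d → Bool) → ℚ
mass {k} {d} θ E = sumOver (allLabs k d) (λ τ → edgeWeight θ τ * ind (E τ))

prob≡half-mass : ∀ k d θ (E : FullLab k d → Bool) → Prob k d θ E ≡ half * mass θ E
prob≡half-mass k d θ E =
  ≡-trans (sumOver-filter (allLabs k d) (weight θ) E)
    (≡-trans (sumOver-cong (allLabs k d) (λ σ → Qₚ.*-assoc half (edgeWeight θ σ) (ind (E σ))))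
             (sumOver-*ˡ (allLabs k d) half _))

mass-cong : ∀ {k d} θ {E E′ : FullLab k d → Bool} → (∀ τ → E τ ≡ E′ τ) → mass θ E ≡ mass θ E′
mass-cong {k} {d} θ E≡E′ = sumOver-cong (allLabs k d) (λ τ → cong (λ e → edgeWeight θ τ * ind e) (E≡E′ τ))

lik : ∀ {k d} → ℚ → Bool → LeafConf k d → ℚ
lik θ c y = mass θ (λ τ → eqB (rootLab τ) c ∧ leavesMatch y τ)

parentLik : ∀ {k d} → ℚ → Bool → LeafConf k d → ℚ
parentLik θ b y = trans θ b true * lik θ true y + trans θ b false * lik θ false y

subconf : ∀ {k d} → LeafConf k (suc d) → Fin k → LeafConf k d
subconf x i p = x (_∷_ i p)

prob-root-leaves : ∀ k d θ (y : LeafConf k d) →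
  Prob k d θ (λ σ → rootIsOne σ ∧ leavesMatch y σ) ≡ half * lik θ true y
prob-root-leaves k d θ y =
  ≡-trans (prob≡half-mass k d θ _) (cong (half *_) (mass-cong θ (λ τ → cong (_∧ leavesMatch y τ) (is-true (rootLab τ)))))
  where
  is-true : ∀ b → b ≡ eqB b true
  is-true true  = refl
  is-true false = refl

prob-leaves : ∀ k d θ (y : LeafConf k d) →
  Prob k d θ (leavesMatch y) ≡ half * (lik θ true y + lik θ false y)
prob-leaves k d θ y =
  ≡-trans (prob≡half-mass k d θ _)
    (cong (half *_) (≡-trans (sumOver-cong (allLabs k d) (λ τ → split (rootLab τ) (edgeWeight θ τ) (leavesMatch y τ)))
                             (sumOver-+ (allLabs k d) _ _)))
  where
  split : ∀ r e m → e * ind m ≡ e * ind (eqB r true ∧ m) + e * ind (eqB r false ∧ m)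
  split true  e m = solve 2 (λ e v → e :* v := e :* v :+ e :* con 0ℚ) refl e (ind m)
  split false e m = solve 2 (λ e v → e :* v := e :* con 0ℚ :+ e :* v) refl e (ind m)

parentLik-sum : ∀ k d θ b (y : LeafConf k d) →
  sumOver (allLabs k d) (λ τ → trans θ b (rootLab τ) * edgeWeight θ τ * ind (leavesMatch y τ)) ≡ parentLik θ b y
parentLik-sum k d θ b y =
  ≡-trans (sumOver-cong (allLabs k d) (λ τ → split (rootLab τ) (edgeWeight θ τ) (leavesMatch y τ)))
    (≡-trans (sumOver-+ (allLabs k d) _ _)
             (cong₂ _+_ (sumOver-*ˡ (allLabs k d) (trans θ b true) _) (sumOver-*ˡ (allLabs k d) (trans θ b false) _)))
  where
  split : ∀ r e m → trans θ b r * e * ind m ≡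
    trans θ b true * (e * ind (eqB r true ∧ m)) + trans θ b false * (e * ind (eqB r false ∧ m))
  split true  e m = solve 4 (λ t₁ t₀ e v → t₁ :* e :* v := t₁ :* (e :* v) :+ t₀ :* (e :* con 0ℚ))
    refl (trans θ b true) (trans θ b false) e (ind m)
  split false e m = solve 4 (λ t₁ t₀ e v → t₀ :* e :* v := t₁ :* (e :* con 0ℚ) :+ t₀ :* (e :* v))
    refl (trans θ b true) (trans θ b false) e (ind m)

-- Identity (2): the subtrees of the root are conditionally independent given its label.
lik-node : ∀ k d θ c (x : LeafConf k (suc d)) →
  lik θ c x ≡ prodFin k (λ j → parentLik θ c (subconf x j))
lik-node k d θ c x = begin
  lik θ c x
    ≡⟨ sumLabs-node k d θ _ (λ b → ind (eqB b c)) (λ j τ → ind (leavesMatch (subconf x j) τ)) factors ⟩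
  sumOver labels (λ b → ind (eqB b c) * prodFin k (λ j → subtree b j))
    ≡⟨ sumOver-labels-ind c (λ b → prodFin k (λ j → subtree b j)) ⟩
  prodFin k (λ j → subtree c j)
    ≡⟨ prodFin-cong k (λ j → parentLik-sum k d θ c (subconf x j)) ⟩
  prodFin k (λ j → parentLik θ c (subconf x j)) ∎
  where
  open ≡-Reasoning
  subtree : Bool → Fin k → ℚ
  subtree b j = sumOver (allLabs k d) (λ τ → trans θ b (rootLab τ) * edgeWeight θ τ * ind (leavesMatch (subconf x j) τ))
  factors : ∀ b ch → ind (eqB b c ∧ leavesMatch x (node b ch)) ≡
    ind (eqB b c) * prodFin k (λ j → ind (leavesMatch (subconf x j) (ch j)))
  factors b ch = ≡-trans (ind-∧ (eqB b c) _)
    (cong (ind (eqB b c) *_) (ind-and k (λ j → leavesMatch (subconf x j) (ch j)) (λ j → j)))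

prob-subtree : ∀ k d θ (i : Fin k) (E : FullLab k (suc d) → Bool) (G : FullLab k d → Bool) →
  (∀ b ch → E (node b ch) ≡ G (ch i)) → Prob k (suc d) θ E ≡ Prob k d θ G
prob-subtree k d θ i E G E-local = begin
  Prob k (suc d) θ E
    ≡⟨ prob≡half-mass k (suc d) θ E ⟩
  half * mass θ E
    ≡⟨ cong (half *_) (sumLabs-node k d θ _ (λ _ → 1ℚ) (λ j τ → single i j (ind (G τ))) factors) ⟩
  half * sumOver labels (λ b → 1ℚ * prodFin k (λ j → sumOver (allLabs k d) (h b j)))
    ≡⟨ cong (half *_) (sumOver-cong labels (λ b → ≡-trans (Qₚ.*-identityˡ _)
         (≡-trans (prodFin-cong k (λ j → pull-single b j)) (prodFin-single k i (λ j → child b))))) ⟩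
  half * sumOver labels child
    ≡⟨ cong (half *_) (sumOver-swap labels (allLabs k d) (λ b τ → trans θ b (rootLab τ) * edgeWeight θ τ * ind (G τ))) ⟩
  half * sumOver (allLabs k d) (λ τ → sumOver labels (λ b → trans θ b (rootLab τ) * edgeWeight θ τ * ind (G τ)))
    ≡⟨ cong (half *_) (sumOver-cong (allLabs k d) marginal) ⟩
  half * mass θ G
    ≡⟨ sym (prob≡half-mass k d θ G) ⟩
  Prob k d θ G ∎
  where
  open ≡-Reasoning
  h : Bool → Fin k → FullLab k d → ℚ
  h b j τ = trans θ b (rootLab τ) * edgeWeight θ τ * single i j (ind (G τ))
  child : Bool → ℚ
  child b = sumOver (allLabs k d) (λ τ → trans θ b (rootLab τ) * edgeWeight θ τ * ind (G τ))
  factors : ∀ b ch → ind (E (node b ch)) ≡ 1ℚ * prodFin k (λ j → single i j (ind (G (ch j))))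
  factors b ch = ≡-trans (cong ind (E-local b ch))
    (sym (≡-trans (Qₚ.*-identityˡ _) (prodFin-single k i (λ j → ind (G (ch j))))))
  -- off the child i the subtree is summed out completely
  pull-single : ∀ b j → sumOver (allLabs k d) (h b j) ≡ single i j (child b)
  pull-single b j with does (i ≟ j)
  ... | true  = refl
  ... | false = ≡-trans (sumOver-cong (allLabs k d) (λ τ → Qₚ.*-identityʳ _)) (total-mass k d θ b)
  -- the child's label is uniform, as the root's is
  marginal : ∀ τ → sumOver labels (λ b → trans θ b (rootLab τ) * edgeWeight θ τ * ind (G τ)) ≡
    edgeWeight θ τ * ind (G τ)
  marginal τ = ≡-trans (sumOver-cong labels (λ b → Qₚ.*-assoc (trans θ b (rootLab τ)) (edgeWeight θ τ) (ind (G τ))))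
    (trans-colSum θ (rootLab τ) (edgeWeight θ τ * ind (G τ)))

lik-leaf : ∀ {k} θ c (y : LeafConf k 0) → lik θ c y ≡ ind (eqB c (y []))
lik-leaf θ c y = leaf-sum c (y [])
  where
  leaf-sum : ∀ c v → 1ℚ * ind (eqB true c ∧ eqB true v) + (1ℚ * ind (eqB false c ∧ eqB false v) + 0ℚ) ≡ ind (eqB c v)
  leaf-sum true  true  = refl
  leaf-sum true  false = refl
  leaf-sum false true  = refl
  leaf-sum false false = refl

parentLik-leaf : ∀ {k} θ b (y : LeafConf k 0) → parentLik θ b y ≡ trans θ b (y [])
parentLik-leaf θ b y =
  ≡-trans (cong₂ (λ u v → trans θ b true * u + trans θ b false * v) (lik-leaf θ true y) (lik-leaf θ false y))
          (select-leaf (y []))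
  where
  select-leaf : ∀ v → trans θ b true * ind (eqB true v) + trans θ b false * ind (eqB false v) ≡ trans θ b v
  select-leaf true  = solve 2 (λ t₁ t₀ → t₁ :* con 1ℚ :+ t₀ :* con 0ℚ := t₁) refl (trans θ b true) (trans θ b false)
  select-leaf false = solve 2 (λ t₁ t₀ → t₁ :* con 0ℚ :+ t₀ :* con 1ℚ := t₀) refl (trans θ b true) (trans θ b false)

condProb-≢0 : ∀ k d θ (A B : FullLab k d → Bool) (P≢0 : ¬ (Prob k d θ B ≡ 0ℚ)) →
  CondProb k d θ A B ≡ (Prob k d θ (λ σ → A σ ∧ B σ) ÷ Prob k d θ B) {{≢-nonZero P≢0}}
condProb-≢0 k d θ A B P≢0 with Prob k d θ B Q.≟ 0ℚ
... | yes P≡0 = ⊥-elim (P≢0 P≡0)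
... | no _    = refl

condProb-≡0 : ∀ k d θ (A B : FullLab k d → Bool) → Prob k d θ B ≡ 0ℚ → CondProb k d θ A B ≡ 0ℚ
condProb-≡0 k d θ A B P≡0 with Prob k d θ B Q.≟ 0ℚ
... | yes _   = refl
... | no P≢0  = ⊥-elim (P≢0 P≡0)

≤-÷⇒*-≤ : ∀ c q p .{{_ : Q.NonZero p}} → 0ℚ Q.≤ p → c Q.≤ q ÷ p → c * p Q.≤ q
≤-÷⇒*-≤ c q p 0≤p c≤q/p = begin
  c * p            ≤⟨ Qₚ.*-monoʳ-≤-nonNeg p {{Q.nonNegative 0≤p}} c≤q/p ⟩
  q * 1/ p * p     ≡⟨ Qₚ.*-assoc q (1/ p) p ⟩
  q * (1/ p * p)   ≡⟨ cong (q *_) (Qₚ.*-inverseˡ p) ⟩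
  q * 1ℚ           ≡⟨ Qₚ.*-identityʳ q ⟩
  q                ∎
  where open Qₚ.≤-Reasoning

*-≤⇒≤-÷ : ∀ c q p .{{_ : Q.Positive p}} → c * p Q.≤ q → c Q.≤ (q ÷ p) {{Qₚ.pos⇒nonZero p}}
*-≤⇒≤-÷ c q p cp≤q = begin
  c                ≡⟨ sym (Qₚ.*-identityʳ c) ⟩
  c * 1ℚ           ≡⟨ cong (c *_) (sym (Qₚ.*-inverseʳ p)) ⟩
  c * (p * 1/ p)   ≡⟨ sym (Qₚ.*-assoc c p (1/ p)) ⟩
  c * p * 1/ p     ≤⟨ Qₚ.*-monoʳ-≤-nonNeg (1/ p) {{Qₚ.pos⇒nonNeg (1/ p) {{Qₚ.1/pos⇒pos p}}}} cp≤q ⟩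
  q * 1/ p         ∎
  where
  open Qₚ.≤-Reasoning
  instance
    p≢0 : Q.NonZero p
    p≢0 = Qₚ.pos⇒nonZero p

-- A positive lower bound c on P[A | B] means c · P[B] ≤ P[A ∧ B] (P[B] = 0 is excluded by c > 0).
condProb-lower⇒ : ∀ k d θ (A B : FullLab k d → Bool) {c} → 0ℚ Q.< c → 0ℚ Q.≤ Prob k d θ B →
  c Q.≤ CondProb k d θ A B → c * Prob k d θ B Q.≤ Prob k d θ (λ σ → A σ ∧ B σ)
condProb-lower⇒ k d θ A B {c} 0<c 0≤P c≤cond = byCases (Prob k d θ B Q.≟ 0ℚ)
  where
  byCases : Dec (Prob k d θ B ≡ 0ℚ) → c * Prob k d θ B Q.≤ Prob k d θ (λ σ → A σ ∧ B σ)
  byCases (yes P≡0) = ⊥-elim (Qₚ.<-irrefl refl (Qₚ.<-≤-trans 0<c (Qₚ.≤-trans c≤cond (Qₚ.≤-reflexive (condProb-≡0 k d θ A B P≡0)))))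
  byCases (no P≢0)  = ≤-÷⇒*-≤ c _ _ {{≢-nonZero P≢0}} 0≤P
    (Qₚ.≤-trans c≤cond (Qₚ.≤-reflexive (condProb-≢0 k d θ A B P≢0)))

condProb-lower⇐ : ∀ k d θ (A B : FullLab k d → Bool) {c} → 0ℚ Q.< Prob k d θ B →
  c * Prob k d θ B Q.≤ Prob k d θ (λ σ → A σ ∧ B σ) → c Q.≤ CondProb k d θ A B
condProb-lower⇐ k d θ A B {c} 0<P cP≤P∧ =
  Qₚ.≤-trans (*-≤⇒≤-÷ c _ _ {{Q.positive 0<P}} cP≤P∧) (Qₚ.≤-reflexive (sym (condProb-≢0 k d θ A B P≢0)))
  where
  P≢0 : ¬ (Prob k d θ B ≡ 0ℚ)
  P≢0 P≡0 = Qₚ.<⇒≢ 0<P (sym P≡0)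

Nondegenerate : ℚ → Set
Nondegenerate θ = ∀ b c → 0ℚ Q.< trans θ b c

module _ {θ : ℚ} (nondeg : Nondegenerate θ) where

  edgeWeight-nonneg : ∀ {k d} (σ : FullLab k d) → 0ℚ Q.≤ edgeWeight θ σ
  edgeWeight-nonneg (leaf b)        = Qₚ.≤ᵇ⇒≤ _
  edgeWeight-nonneg {k} (node b ch) =
    prodFin-nonneg k _ (λ i → 0≤-* (Qₚ.<⇒≤ (nondeg b (rootLab (ch i)))) (edgeWeight-nonneg (ch i)))

  mass-nonneg : ∀ {k d} (E : FullLab k d → Bool) → 0ℚ Q.≤ mass θ E
  mass-nonneg {k} {d} E = sumOver-nonneg (allLabs k d) _ (λ τ → 0≤-* (edgeWeight-nonneg τ) (ind-nonneg (E τ)))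

  lik-nonneg : ∀ {k d} c (y : LeafConf k d) → 0ℚ Q.≤ lik θ c y
  lik-nonneg {k} {d} c y = mass-nonneg {k} {d} (λ τ → eqB (rootLab τ) c ∧ leavesMatch y τ)

  -- In a tree of depth ≥ 1 every root label has positive likelihood, and at every depth every
  -- parent label has; the two statements are proved by a joint induction on the depth.
  lik-pos : ∀ k d c (y : LeafConf k (suc d)) → 0ℚ Q.< lik θ c y
  parentLik-pos : ∀ k d b (y : LeafConf k d) → 0ℚ Q.< parentLik θ b y

  lik-pos k d c y = subst (0ℚ Q.<_) (sym (lik-node k d θ c y))
    (prodFin-pos k _ (λ j → parentLik-pos k d c (subconf y j)))

  parentLik-pos k zero    b y = subst (0ℚ Q.<_) (sym (parentLik-leaf θ b y)) (nondeg b (y []))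
  parentLik-pos k (suc d) b y =
    0<-+ (0<-* (nondeg b true) (lik-pos k d true y)) (Qₚ.<⇒≤ (0<-* (nondeg b false) (lik-pos k d false y)))

  rootPosterior-lower : ∀ k d c (y : LeafConf k (suc d)) →
    c * (lik θ true y + lik θ false y) Q.≤ lik θ true y →
    c Q.≤ CondProb k (suc d) θ rootIsOne (leavesMatch y)
  rootPosterior-lower k d c y cL≤L₁ = condProb-lower⇐ k (suc d) θ rootIsOne (leavesMatch y)
    (subst (0ℚ Q.<_) (sym (prob-leaves k (suc d) θ y))
      (0<-* (Qₚ.positive⁻¹ half) (0<-+ (lik-pos k d true y) (lik-nonneg false y))))
    (subst₂ (λ u v → c * u Q.≤ v) (sym (prob-leaves k (suc d) θ y)) (sym (prob-root-leaves k (suc d) θ y))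
      (half-scale c _ _ cL≤L₁))

  childPosterior-lower : ∀ k d c i (x : LeafConf k (suc d)) → 0ℚ Q.< c →
    c Q.≤ CondProb k (suc d) θ (childIsOne i) (subLeavesMatch x i) →
    c * (lik θ true (subconf x i) + lik θ false (subconf x i)) Q.≤ lik θ true (subconf x i)
  childPosterior-lower k d c i x 0<c c≤cond = half-cancel c _ _
    (subst₂ (λ u v → c * u Q.≤ v) prob-below prob-one-below
      (condProb-lower⇒ k (suc d) θ (childIsOne i) (subLeavesMatch x i) 0<c 0≤prob-below c≤cond))
    where
    y : LeafConf k d
    y = subconf x i
    prob-below : Prob k (suc d) θ (subLeavesMatch x i) ≡ half * (lik θ true y + lik θ false y)
    prob-below = ≡-trans (prob-subtree k d θ i _ (leavesMatch y) (λ b ch → refl)) (prob-leaves k d θ y)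
    prob-one-below : Prob k (suc d) θ (λ σ → childIsOne i σ ∧ subLeavesMatch x i σ) ≡ half * lik θ true y
    prob-one-below = ≡-trans (prob-subtree k d θ i _ (λ τ → rootIsOne τ ∧ leavesMatch y τ) (λ b ch → refl))
                             (prob-root-leaves k d θ y)
    0≤prob-below : 0ℚ Q.≤ Prob k (suc d) θ (subLeavesMatch x i)
    0≤prob-below = subst (0ℚ Q.≤_) (sym prob-below)
      (0≤-* {half} (Qₚ.≤ᵇ⇒≤ _) (Qₚ.+-mono-≤ (lik-nonneg true y) (lik-nonneg false y)))

θ₀ : ℚ
θ₀ = + 9 / 10

θ₀-nondeg : Nondegenerate θ₀
θ₀-nondeg true  true  = Qₚ.positive⁻¹ _
θ₀-nondeg true  false = Qₚ.positive⁻¹ _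
θ₀-nondeg false true  = Qₚ.positive⁻¹ _
θ₀-nondeg false false = Qₚ.positive⁻¹ _

strongChildOdds : ∀ {k d} (y : LeafConf k d) →
  (+ 19 / 20) * (lik θ₀ true y + lik θ₀ false y) Q.≤ lik θ₀ true y →
  (+ 181 / 19) * parentLik θ₀ false y Q.≤ parentLik θ₀ true y
strongChildOdds y h = ≤-byGap (gap (lik θ₀ true y) (lik θ₀ false y)) (0≤-* {+ 180 / 19} (Qₚ.≤ᵇ⇒≤ _) (0≤-difference h))
  where
  gap : ∀ a b → (+ 19 / 20) * a + (+ 1 / 20) * b ≡
    (+ 181 / 19) * ((+ 1 / 20) * a + (+ 19 / 20) * b) + (+ 180 / 19) * (a - (+ 19 / 20) * (a + b))
  gap = solve 2 (λ a b → con (+ 19 / 20) :* a :+ con (+ 1 / 20) :* b :=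
    con (+ 181 / 19) :* (con (+ 1 / 20) :* a :+ con (+ 19 / 20) :* b) :+
    con (+ 180 / 19) :* (a :- con (+ 19 / 20) :* (a :+ b))) refl

weakChildOdds : ∀ {k d} (y : LeafConf k d) → 0ℚ Q.≤ lik θ₀ true y →
  (+ 1 / 19) * parentLik θ₀ false y Q.≤ parentLik θ₀ true y
weakChildOdds y 0≤L₁ = ≤-byGap (gap (lik θ₀ true y) (lik θ₀ false y)) (0≤-* {+ 18 / 19} (Qₚ.≤ᵇ⇒≤ _) 0≤L₁)
  where
  gap : ∀ a b → (+ 19 / 20) * a + (+ 1 / 20) * b ≡
    (+ 1 / 19) * ((+ 1 / 20) * a + (+ 19 / 20) * b) + (+ 18 / 19) * a
  gap = solve 2 (λ a b → con (+ 19 / 20) :* a :+ con (+ 1 / 20) :* b :=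
    con (+ 1 / 19) :* (con (+ 1 / 20) :* a :+ con (+ 19 / 20) :* b) :+ con (+ 18 / 19) :* a) refl

goodChildren-odds : (S : Subset 6) → 4 ≤ ∣ S ∣ → (+ 19 / 1) Q.≤ prodFin 6 (select S (+ 181 / 19) (+ 1 / 19))
goodChildren-odds S 4≤∣S∣ =
  subst ((+ 19 / 1) Q.≤_) (sym (≡-trans (prodFin-select S _ _) (cong (λ m → _ ^ ∣ S ∣ * _ ^ m) (∣∁p∣≡n∸∣p∣ S))))
    (bound ∣ S ∣ 4≤∣S∣ (∣p∣≤n S))
  where
  bound : ∀ m → 4 ≤ m → m ≤ 6 → (+ 19 / 1) Q.≤ (+ 181 / 19) ^ m * (+ 1 / 19) ^ (6 ∸ m)
  bound 1 (s≤s ()) _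
  bound 2 (s≤s (s≤s ())) _
  bound 3 (s≤s (s≤s (s≤s ()))) _
  bound 4 _ _ = Qₚ.≤ᵇ⇒≤ _
  bound 5 _ _ = Qₚ.≤ᵇ⇒≤ _
  bound 6 _ _ = Qₚ.≤ᵇ⇒≤ _
  bound (suc (suc (suc (suc (suc (suc (suc _))))))) _ (s≤s (s≤s (s≤s (s≤s (s≤s (s≤s ()))))))

odds⇒posterior : ∀ a b → (+ 19 / 1) * b Q.≤ a → (+ 19 / 20) * (a + b) Q.≤ a
odds⇒posterior a b 19b≤a = ≤-byGap (gap a b) (0≤-* {+ 1 / 20} (Qₚ.≤ᵇ⇒≤ _) (0≤-difference 19b≤a))
  where
  gap : ∀ a b → a ≡ (+ 19 / 20) * (a + b) + (+ 1 / 20) * (a - (+ 19 / 1) * b)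
  gap = solve 2 (λ a b → a := con (+ 19 / 20) :* (a :+ b) :+ con (+ 1 / 20) :* (a :- con (+ 19 / 1) :* b)) refl

mainTheorem4 : (n : ℕ) → (x : LeafConf 6 (suc n)) →
    Σ (Subset 6) (λ S → (4 ≤ ∣ S ∣) ×
      (∀ i → i ∈ S →
        (+ 19 / 20) Data.Rational.≤
          CondProb 6 (suc n) (+ 9 / 10) (childIsOne i) (subLeavesMatch x i))) →
    (+ 19 / 20) Data.Rational.≤ CondProb 6 (suc n) (+ 9 / 10) rootIsOne (leavesMatch x)
mainTheorem4 n x (S , 4≤∣S∣ , goodChild) =
  rootPosterior-lower {θ₀} θ₀-nondeg 6 n (+ 19 / 20) x (odds⇒posterior (lik θ₀ true x) (lik θ₀ false x) rootOdds)
  where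
  odds : Fin 6 → ℚ
  odds = select S (+ 181 / 19) (+ 1 / 19)
  childOdds : ∀ j → odds j * parentLik θ₀ false (subconf x j) Q.≤ parentLik θ₀ true (subconf x j)
  childOdds j with lookup S j in S[j]
  ... | true  = strongChildOdds (subconf x j) (childPosterior-lower {θ₀} θ₀-nondeg 6 n (+ 19 / 20) j x
                  (Qₚ.positive⁻¹ _) (goodChild j (lookup⇒[]= j S S[j])))
  ... | false = weakChildOdds (subconf x j) (lik-nonneg {θ₀} θ₀-nondeg true (subconf x j))
  rootOdds : (+ 19 / 1) * lik θ₀ false x Q.≤ lik θ₀ true x
  rootOdds = subst₂ (λ u v → (+ 19 / 1) * u Q.≤ v) (sym (lik-node 6 n θ₀ false x)) (sym (lik-node 6 n θ₀ true x))
    (prodFin-ratio 6 (+ 19 / 1) odds (λ j → parentLik θ₀ true (subconf x j)) (λ j → parentLik θ₀ false (subconf x j))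
      (select-nonneg S (Qₚ.≤ᵇ⇒≤ _) (Qₚ.≤ᵇ⇒≤ _))
      (λ j → Qₚ.<⇒≤ (parentLik-pos {θ₀} θ₀-nondeg 6 n false (subconf x j)))
      (goodChildren-odds S 4≤∣S∣) childOdds)
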